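{- Let $G$ and $H$ be simple $\{0,1\}$-matrices with the same number of rows that have no columns in common, and for $t\ge1$ let $F_t=[G\,|\,t\cdot H]$. Then $X(F_2)=X(F_t)$ for all $t\ge2$. In particular, if it were true that ${\mathrm{forb}}(m,F)\in\Theta(m^{X(F)})$ for every $\{0,1\}$-matrix $F$, then ${\mathrm{forb}}(m,F_t)$ and ${\mathrm{forb}}(m,F_2)$ would have the same asymptotic behaviour (order of growth in $m$).
   Context: A $\{0,1\}$-matrix is simple if it has no repeated columns. For matrices $A,B$ with the same number of rows, $[A\,|\,B]$ is the concatenation (all columns of $A$ together with all columns of $B$), and $t\cdot A=[A\,|\,A\,|\cdots|\,A]$ ($t$ copies). A $\{0,1\}$-matrix $F$ is a subconfiguration of a $\{0,1\}$-matrix $A$, written $F\prec A$, if some matrix obtained from $F$ by permuting its rows and permuting its columns is a submatrix of $A$ (column multiplicities count). ${\mathrm{forb}}(m,F)$ is the maximum number of columns of a simple $\{0,1\}$-matrix with $m$ rows that does not have $F$ as a subconfiguration. For $\{0,1\}$-matrices $A$ and $B$, the product $A\times B$ is the matrix whose columns are all columns obtained by placing a column of $A$ on top of a column of $B$, over all pairs of columns. For $r\ge1$: $\mathcal{I}_r$ is the $r\times r$ identity matrix, $\mathcal{I}_r^c$ its $\{0,1\}$-complement, and $\mathcal{T}_r$ the $r\times(r+1)$ matrix whose $j$-th column ($j=0,\dots,r$) has ones exactly in its first $j$ rows. For nonnegative integers $a,b,c$, $P_r(a,b,c)$ is the product of $a$ copies of $\mathcal{I}_r$, $b$ copies of $\mathcal{I}_r^c$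 and $c$ copies of $\mathcal{T}_r$. $X(F)$ is the largest integer $N$ such that there exist nonnegative integers $a,b,c$ with $a+b+c=N$ and $F\not\prec P_r(a,b,c)$ for all $r\in\mathbb{N}$. -}

module Defs where

open import Data.Bool using (Bool; true; false; not)
open import Data.Nat using (ℕ; zero; suc; _+_; _*_; _^_; _≤_; _<ᵇ_)
open import Data.Fin using (Fin; toℕ; _≟_)
open import Data.Fin.Base using ()
open import Data.Vec using (Vec; []; tabulate) renaming (lookup to vlookup; _++_ to _++ᵥ_)
open import Data.List using (List; []; _∷_; map; concatMap; concat; replicate; length; allFin; _++_)
  renaming (lookup to llookup)
open import Data.List.Relation.Unary.Unique.Propositional using (Unique)
open import Data.List.Membership.Propositional using (_∈_; _∉_)
open import Data.Product using (Σ; ∃; _×_; _,_)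
open import Relation.Nullary using (¬_)
open import Relation.Nullary.Decidable using (⌊_⌋)
open import Relation.Binary.PropositionalEquality using (_≡_)
open import Function.Definitions using (Injective)
open import Function.Bundles using (_⇔_)

-- A {0,1}-matrix with k rows, represented as the list of its columns
-- (column multiplicities are kept; the list order is irrelevant for ≺).
Mat : ℕ → Set
Mat k = List (Vec Bool k)

Simple : ∀ {k} → Mat k → Set
Simple = Unique

_∣∣_ : ∀ {k} → Mat k → Mat k → Mat k
A ∣∣ B = A ++ B

_·_ : ∀ {k} → ℕ → Mat k → Mat k
t · A = concat (replicate t A)

entry : ∀ {k} (A : Mat k) → Fin k → Fin (length A) → Bool
entry A i j = vlookup (llookup A j) i

-- F ≺ A : some row/column permutation of F is a submatrix of A, i.e.
-- there are injective row and column maps embedding F into A.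
_≺_ : ∀ {k m} → Mat k → Mat m → Set
_≺_ {k} {m} F A =
  Σ (Fin k → Fin m) λ σ → Injective _≡_ _≡_ σ ×
  Σ (Fin (length F) → Fin (length A)) λ τ → Injective _≡_ _≡_ τ ×
  (∀ i j → entry A (σ i) (τ j) ≡ entry F i j)

_⊠_ : ∀ {p q} → Mat p → Mat q → Mat (p + q)
A ⊠ B = concatMap (λ a → map (λ b → a ++ᵥ b) B) A

-- n-fold product (the empty product has 0 rows and one (empty) column)
pow : ∀ {r} → (n : ℕ) → Mat r → Mat (n * r)
pow zero M = [] ∷ []
pow (suc n) M = M ⊠ pow n M

Iden : (r : ℕ) → Mat r
Iden r = map (λ j → tabulate (λ i → ⌊ i ≟ j ⌋)) (allFin r)

IdenC : (r : ℕ) → Mat r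
IdenC r = map (λ j → tabulate (λ i → not ⌊ i ≟ j ⌋)) (allFin r)

Tri : (r : ℕ) → Mat r
Tri r = map (λ j → tabulate (λ i → toℕ i <ᵇ toℕ j)) (allFin (suc r))

P : (r a b c : ℕ) → Mat (a * r + (b * r + c * r))
P r a b c = pow a (Iden r) ⊠ (pow b (IdenC r) ⊠ pow c (Tri r))

Attainable : ∀ {k} → Mat k → ℕ → Set
Attainable F N = ∃ λ a → ∃ λ b → ∃ λ c → (a + b + c ≡ N) ×
  (∀ r → 1 ≤ r → ¬ (F ≺ P r a b c))

IsX : ∀ {k} → Mat k → ℕ → Set
IsX F N = Attainable F N × (∀ N' → Attainable F N' → N' ≤ N)

IsForb : ∀ {k} → (m : ℕ) → Mat k → ℕ → Set
IsForb m F n =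
  (Σ (Mat m) λ A → Simple A × length A ≡ n × ¬ (F ≺ A)) ×
  (∀ (A : Mat m) → Simple A → ¬ (F ≺ A) → length A ≤ n)

BigΘ : (ℕ → ℕ) → (ℕ → ℕ) → Set
BigΘ f g = ∃ λ c₁ → ∃ λ c₂ → ∃ λ m₀ → ∀ m → m₀ ≤ m → (f m ≤ c₁ * g m) × (g m ≤ c₂ * f m)

NoCommonColumns : ∀ {k} → Mat k → Mat k → Set
NoCommonColumns G H = ∀ v → v ∈ G → v ∉ H

ForbConjecture : Set
ForbConjecture = ∀ k (F : Mat k) X → IsX F X →
  ∀ (f : ℕ → ℕ) → (∀ m → IsForb m F (f m)) → BigΘ f (λ m → m ^ X)

-- F ≺ A holds iff some injective map σ from the rows of F to those of A is such that, for every column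
-- v of F, A has at least as many columns agreeing with v on the rows σ as F has copies of v. Hence
-- F_t ≺ A implies F_2 ≺ A, so every N attainable for F_2 is attainable for F_t. Conversely, put t = t' + 1
-- and send row i of each factor I_r, I_r^c, T_r of P_r(a,b,c) to row t' + ti of the corresponding factor
-- of P_R(a,b,c), R = t' + rt. Then no pattern of prescribed entries on the chosen rows is matched by
-- fewer columns, and one matched by at least two columns is matched by at least t times as many: in T_R
-- each column of T_r reappears t times, in I_R a pattern matched twice prescribes only zeros, and the
-- property passes to products. As every column of H has two copies in F_2, a copy of F_2 in P_r(a,b,c)
-- yields a copy of F_t in P_R(a,b,c). So F_2 and F_t have the same attainable numbers and the same X,
-- and under the conjecture forb(m, F_2) and forb(m, F_t) are both Θ(m^X).

module Submission where

open import Defs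

open import Algebra.Bundles using (CommutativeMonoid)
open import Data.Bool using (Bool; true; false; not; _∧_; T)
import Data.Bool.Properties as Boolₚ
open import Data.Empty using (⊥-elim)
open import Data.Fin using (Fin; zero; suc; toℕ; _≟_; punchIn; punchOut; _↑ˡ_; _↑ʳ_; splitAt; join; combine; quotient; remainder)
import Data.Fin.Properties as Finₚ
open import Data.List using (List; []; _∷_; _++_; map; concat; replicate; length; tabulate; allFin) renaming (lookup to lookupᴸ)
import Data.List.Properties as Listₚ
open import Data.List.Membership.Propositional using (_∈_)
open import Data.List.Relation.Unary.All as All using (All; []; _∷_)
import Data.List.Relation.Unary.All.Properties as Allₚ
open import Data.List.Relation.Unary.Any using (here; there)
open import Data.Nat using (ℕ; zero; suc; _+_; _*_; _≤_; _<_; _<ᵇ_; z≤n; s≤s; s≤s⁻¹)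
open import Data.Nat.Properties hiding (_≟_)
open import Data.Product using (Σ; ∃; _×_; _,_; proj₁; proj₂; map₁; map₂; swap)
open import Data.Sum as Sum using (_⊎_; inj₁; inj₂; [_,_]′)
import Data.Sum.Properties as Sumₚ
open import Data.Unit using (tt)
open import Data.Vec using (Vec) renaming (lookup to lookupᵛ; _++_ to _++ᵛ_; tabulate to tabulateᵛ)
import Data.Vec.Properties as Vecₚ
open import Function using (_∘_; _⇔_; mk⇔; Equivalence)
import Function.Construct.Composition as Comp
open import Function.Definitions using (Injective)
open import Relation.Binary.Definitions using (DecidableEquality)
open import Relation.Binary.PropositionalEquality
open import Relation.Nullary.Decidable using (⌊_⌋; yes; no; fromWitness; toWitness)

-- Counting

fromBool : Bool → ℕ
fromBool true = 1
fromBool false = 0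

fromBool-mono : ∀ {a b} → (T a → T b) → fromBool a ≤ fromBool b
fromBool-mono {false} _ = z≤n
fromBool-mono {true} {true} _ = s≤s z≤n
fromBool-mono {true} {false} a⇒b = ⊥-elim (a⇒b _)

T-extensional : ∀ {a b} → (T a → T b) → (T b → T a) → a ≡ b
T-extensional {true} {true} _ _ = refl
T-extensional {true} {false} a⇒b _ = ⊥-elim (a⇒b _)
T-extensional {false} {true} _ b⇒a = ⊥-elim (b⇒a _)
T-extensional {false} {false} _ _ = refl

≟-injective : ∀ {m n} (f : Fin m → Fin n) → Injective _≡_ _≡_ f → ∀ a b → ⌊ f a ≟ f b ⌋ ≡ ⌊ a ≟ b ⌋
≟-injective f f-inj a b = T-extensional (fromWitness ∘ f-inj ∘ toWitness) (fromWitness ∘ cong f ∘ toWitness)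

<ᵇ-cong : ∀ {a b c d} → a < b ⇔ c < d → (a <ᵇ b) ≡ (c <ᵇ d)
<ᵇ-cong {a} {b} {c} {d} a<b⇔c<d =
  T-extensional (<⇒<ᵇ ∘ Equivalence.to a<b⇔c<d ∘ <ᵇ⇒< a b) (<⇒<ᵇ ∘ Equivalence.from a<b⇔c<d ∘ <ᵇ⇒< c d)

count : ∀ n → (Fin n → Bool) → ℕ
count zero p = 0
count (suc n) p = fromBool (p zero) + count n (λ j → p (suc j))

count-cong : ∀ n {p q : Fin n → Bool} → (∀ j → p j ≡ q j) → count n p ≡ count n q
count-cong zero p≗q = refl
count-cong (suc n) p≗q = cong₂ _+_ (cong fromBool (p≗q zero)) (count-cong n (λ j → p≗q (suc j)))

count-punchIn : ∀ n (p : Fin (suc n) → Bool) (i : Fin (suc n)) →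
  count (suc n) p ≡ fromBool (p i) + count n (λ j → p (punchIn i j))
count-punchIn n p zero = refl
count-punchIn (suc n) p (suc i) = begin
    fromBool (p zero) + count (suc n) (λ j → p (suc j))
  ≡⟨ cong (fromBool (p zero) +_) (count-punchIn n (λ j → p (suc j)) i) ⟩
    fromBool (p zero) + (fromBool (p (suc i)) + count n (λ j → p (suc (punchIn i j))))
  ≡⟨ x∙yz≈y∙xz (fromBool (p zero)) (fromBool (p (suc i))) _ ⟩
    fromBool (p (suc i)) + (fromBool (p zero) + count n (λ j → p (suc (punchIn i j))))
  ∎
  where
  open ≡-Reasoning
  open import Algebra.Properties.CommutativeSemigroup +-commutativeSemigroup using (x∙yz≈y∙xz)

count-mono-injective : ∀ n m (p : Fin n → Bool) (q : Fin m → Bool) (τ : Fin n → Fin m) →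
  Injective _≡_ _≡_ τ → (∀ j → T (p j) → T (q (τ j))) → count n p ≤ count m q
count-mono-injective zero m p q τ τ-inj p⇒q = z≤n
count-mono-injective (suc n) zero p q τ τ-inj p⇒q with () ← τ zero
count-mono-injective (suc n) (suc m) p q τ τ-inj p⇒q = begin
    fromBool (p zero) + count n (λ j → p (suc j))
  ≤⟨ +-mono-≤ (fromBool-mono (p⇒q zero)) (count-mono-injective n m _ _ τ' τ'-inj p⇒q') ⟩
    fromBool (q (τ zero)) + count m (λ j → q (punchIn (τ zero) j))
  ≡⟨ count-punchIn m q (τ zero) ⟨
    count (suc m) q
  ∎
  where
  open ≤-Reasoning
  τ0≢τsuc : ∀ j → τ zero ≢ τ (suc j)
  τ0≢τsuc j e with () ← τ-inj e
  τ' : Fin n → Fin m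
  τ' j = punchOut (τ0≢τsuc j)
  τ'-inj : Injective _≡_ _≡_ τ'
  τ'-inj {x} {y} e = Finₚ.suc-injective (τ-inj (Finₚ.punchOut-injective (τ0≢τsuc x) (τ0≢τsuc y) e))
  p⇒q' : ∀ j → T (p (suc j)) → T (q (punchIn (τ zero) (τ' j)))
  p⇒q' j pj = subst (λ z → T (q z)) (sym (Finₚ.punchIn-punchOut (τ0≢τsuc j))) (p⇒q (suc j) pj)

count-witness : ∀ n (p : Fin n → Bool) → 1 ≤ count n p → ∃ λ i → T (p i)
count-witness (suc n) p pos with p zero in p0
... | true = zero , subst T (sym p0) tt
... | false with i , pi ← count-witness n (λ j → p (suc j)) pos = suc i , pi

count-+ : ∀ a b (p : Fin (a + b) → Bool) →
  count (a + b) p ≡ count a (λ i → p (i ↑ˡ b)) + count b (λ j → p (a ↑ʳ j))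
count-+ zero b p = refl
count-+ (suc a) b p =
  trans (cong (fromBool (p zero) +_) (count-+ a b (λ j → p (suc j)))) (sym (+-assoc (fromBool (p zero)) _ _))

count-const : ∀ n b → count n (λ _ → b) ≡ fromBool b * n
count-const zero b = sym (*-zeroʳ (fromBool b))
count-const (suc n) b = trans (cong (fromBool b +_) (count-const n b)) (sym (*-suc (fromBool b) n))

count-quotient : ∀ n t (p : Fin n → Bool) → count (n * t) (λ z → p (quotient t z)) ≡ count n p * t
count-quotient zero t p = refl
count-quotient (suc n) t p = begin
    count (t + n * t) (λ z → p (quotient t z))
  ≡⟨ count-+ t (n * t) _ ⟩
    count t (λ u → p (quotient t (u ↑ˡ n * t))) + count (n * t) (λ z → p (quotient t (t ↑ʳ z)))
  ≡⟨ cong₂ _+_ (trans (count-cong t (λ u → cong p (quotient-↑ˡ u))) (count-const t (p zero)))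
               (trans (count-cong (n * t) (λ z → cong p (quotient-↑ʳ z))) (count-quotient n t (λ j → p (suc j)))) ⟩
    fromBool (p zero) * t + count n (λ j → p (suc j)) * t
  ≡⟨ *-distribʳ-+ t (fromBool (p zero)) _ ⟨
    count (suc n) p * t
  ∎
  where
  open ≡-Reasoning
  quotient-↑ˡ : ∀ u → quotient {suc n} t (u ↑ˡ n * t) ≡ zero
  quotient-↑ˡ u rewrite Finₚ.splitAt-↑ˡ t u (n * t) = refl
  quotient-↑ʳ : ∀ z → quotient {suc n} t (t ↑ʳ z) ≡ suc (quotient {n} t z)
  quotient-↑ʳ z rewrite Finₚ.splitAt-↑ʳ t (n * t) z = refl

count-blowup : ∀ n m t (p : Fin n → Bool) (q : Fin m → Bool) (τ : Fin (n * t) → Fin m) →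
  Injective _≡_ _≡_ τ → (∀ z → T (p (quotient t z)) → T (q (τ z))) → t * count n p ≤ count m q
count-blowup n m t p q τ τ-inj p⇒q = begin
    t * count n p                        ≡⟨ *-comm t (count n p) ⟩
    count n p * t                        ≡⟨ count-quotient n t p ⟨
    count (n * t) (λ z → p (quotient t z)) ≤⟨ count-mono-injective (n * t) m _ q τ τ-inj p⇒q ⟩
    count m q                            ∎
  where open ≤-Reasoning

count-singleton : ∀ n (i : Fin n) → count n (λ j → ⌊ i ≟ j ⌋) ≡ 1
count-singleton (suc n) zero = cong suc (count-const n false)
count-singleton (suc n) (suc i) = trans (count-cong n (≟-injective suc Finₚ.suc-injective i)) (count-singleton n i)

module _ {A : Set} (_≟A_ : DecidableEquality A) where

  _≐_ : ∀ {n} → (Fin n → A) → A → Fin n → Bool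
  (F ≐ v) j = ⌊ F j ≟A v ⌋

  head-occurs : ∀ n (F : Fin (suc n) → A) → 1 ≤ count (suc n) (F ≐ F zero)
  head-occurs n F = ≤-trans (fromBool-mono {true} {(F ≐ F zero) zero} (λ _ → fromWitness refl)) (m≤m+n _ _)

  embedding-from-counts : ∀ n m (F : Fin n → A) (B : Fin m → A) →
    (∀ v → count n (F ≐ v) ≤ count m (B ≐ v)) →
    Σ (Fin n → Fin m) λ τ → Injective _≡_ _≡_ τ × (∀ j → B (τ j) ≡ F j)
  embedding-from-counts zero m F B _ = (λ ()) , (λ { {()} }) , λ ()
  embedding-from-counts (suc n) m F B dominated
    with count-witness m (B ≐ F zero) (≤-trans (head-occurs n F) (dominated (F zero)))
  embedding-from-counts (suc n) zero F B dominated | () , _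
  embedding-from-counts (suc n) (suc m) F B dominated | i , Bi≐F0 = τ , τ-inj , Bτ≡F
    where
    Bi≡F0 : B i ≡ F zero
    Bi≡F0 = toWitness Bi≐F0
    dominated' : ∀ v → count n ((λ j → F (suc j)) ≐ v) ≤ count m ((λ j → B (punchIn i j)) ≐ v)
    dominated' v = +-cancelˡ-≤ (fromBool ((F ≐ v) zero)) _ _ (begin
        count (suc n) (F ≐ v)                                          ≤⟨ dominated v ⟩
        count (suc m) (B ≐ v)                                          ≡⟨ count-punchIn m (B ≐ v) i ⟩
        fromBool ((B ≐ v) i) + count m ((λ j → B (punchIn i j)) ≐ v)   ≡⟨ cong (λ x → fromBool ⌊ x ≟A v ⌋ + _) Bi≡F0 ⟩
        fromBool ((F ≐ v) zero) + count m ((λ j → B (punchIn i j)) ≐ v) ∎)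
      where open ≤-Reasoning
    rest = embedding-from-counts n m (λ j → F (suc j)) (λ j → B (punchIn i j)) dominated'
    τ : Fin (suc n) → Fin (suc m)
    τ zero = i
    τ (suc j) = punchIn i (proj₁ rest j)
    τ-inj : Injective _≡_ _≡_ τ
    τ-inj {zero} {zero} _ = refl
    τ-inj {zero} {suc y} e = ⊥-elim (Finₚ.punchInᵢ≢i i _ (sym e))
    τ-inj {suc x} {zero} e = ⊥-elim (Finₚ.punchInᵢ≢i i _ e)
    τ-inj {suc x} {suc y} e = cong suc (proj₁ (proj₂ rest) (Finₚ.punchIn-injective i _ _ e))
    Bτ≡F : ∀ j → B (τ j) ≡ F j
    Bτ≡F zero = Bi≡F0
    Bτ≡F (suc j) = proj₂ (proj₂ rest) j

countList : {X : Set} → (X → Bool) → List X → ℕ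
countList q [] = 0
countList q (x ∷ xs) = fromBool (q x) + countList q xs

countList-lookup : {X : Set} (q : X → Bool) (xs : List X) →
  countList q xs ≡ count (length xs) (λ j → q (lookupᴸ xs j))
countList-lookup q [] = refl
countList-lookup q (x ∷ xs) = cong (fromBool (q x) +_) (countList-lookup q xs)

countList-cong : {X : Set} {p q : X → Bool} (xs : List X) → (∀ x → p x ≡ q x) → countList p xs ≡ countList q xs
countList-cong [] p≗q = refl
countList-cong (x ∷ xs) p≗q = cong₂ _+_ (cong fromBool (p≗q x)) (countList-cong xs p≗q)

countList-++ : {X : Set} (q : X → Bool) (xs ys : List X) →
  countList q (xs ++ ys) ≡ countList q xs + countList q ys
countList-++ q [] ys = refl
countList-++ q (x ∷ xs) ys =
  trans (cong (fromBool (q x) +_) (countList-++ q xs ys)) (sym (+-assoc (fromBool (q x)) _ _))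

countList-concat-replicate : {X : Set} (q : X → Bool) (t : ℕ) (xs : List X) →
  countList q (concat (replicate t xs)) ≡ t * countList q xs
countList-concat-replicate q zero xs = refl
countList-concat-replicate q (suc t) xs =
  trans (countList-++ q xs _) (cong (countList q xs +_) (countList-concat-replicate q t xs))

countList-map : {X Y : Set} (q : Y → Bool) (f : X → Y) (xs : List X) →
  countList q (map f xs) ≡ countList (λ x → q (f x)) xs
countList-map q f [] = refl
countList-map q f (x ∷ xs) = cong (fromBool (q (f x)) +_) (countList-map q f xs)

countList-tabulate : {X : Set} (q : X → Bool) (n : ℕ) (f : Fin n → X) →
  countList q (tabulate f) ≡ count n (λ j → q (f j))
countList-tabulate q zero f = refl
countList-tabulate q (suc n) f = cong (fromBool (q (f zero)) +_) (countList-tabulate q n (λ j → f (suc j)))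

countList-∧ : {X : Set} (b : Bool) (q : X → Bool) (xs : List X) →
  countList (λ x → b ∧ q x) xs ≡ fromBool b * countList q xs
countList-∧ true q xs = sym (+-identityʳ _)
countList-∧ false q [] = refl
countList-∧ false q (x ∷ xs) = countList-∧ false q xs

-- Patterns and subconfigurations

-- A pattern prescribes the values of some rows; a column matches it if it has those values.
Pattern : ℕ → Set
Pattern m = List (Fin m × Bool)

matches : ∀ {m} → Vec Bool m → Pattern m → Bool
matches x [] = true
matches x ((ρ , b) ∷ ps) = ⌊ lookupᵛ x ρ Boolₚ.≟ b ⌋ ∧ matches x ps

Fits : ∀ {m} → Vec Bool m → Fin m × Bool → Set
Fits x (ρ , b) = lookupᵛ x ρ ≡ b

T-matches : ∀ {m} (x : Vec Bool m) (ps : Pattern m) → T (matches x ps) ⇔ All (Fits x) ps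
T-matches x [] = mk⇔ (λ _ → []) (λ _ → _)
T-matches x ((ρ , b) ∷ ps) = mk⇔
  (λ m → let m₁ , m₂ = Equivalence.to Boolₚ.T-∧ m in toWitness m₁ ∷ Equivalence.to (T-matches x ps) m₂)
  (λ { (f ∷ fs) → Equivalence.from Boolₚ.T-∧ (fromWitness f , Equivalence.from (T-matches x ps) fs) })

T-matches⇒lookup : ∀ {m} (x : Vec Bool m) (ps : Pattern m) {ρ b} → T (matches x ps) → (ρ , b) ∈ ps → lookupᵛ x ρ ≡ b
T-matches⇒lookup x ps x-matches = All.lookup (Equivalence.to (T-matches x ps) x-matches)

Zeros : ∀ {m} → Pattern m → Set
Zeros = All (λ e → proj₂ e ≡ false)

prescribes-one-or-zeros : ∀ {m} (ps : Pattern m) → (∃ λ ρ → (ρ , true) ∈ ps) ⊎ Zeros ps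
prescribes-one-or-zeros [] = inj₂ []
prescribes-one-or-zeros ((ρ , true) ∷ ps) = inj₁ (ρ , here refl)
prescribes-one-or-zeros ((ρ , false) ∷ ps) with prescribes-one-or-zeros ps
... | inj₁ (ρ' , ρ'∈ps) = inj₁ (ρ' , there ρ'∈ps)
... | inj₂ zeros = inj₂ (refl ∷ zeros)

countMatches : ∀ {m} → Pattern m → Mat m → ℕ
countMatches ps A = countList (λ x → matches x ps) A

mapRows : ∀ {m m'} → (Fin m → Fin m') → Pattern m → Pattern m'
mapRows φ = map (map₁ φ)

matches-mapRows : ∀ {m m'} (φ : Fin m → Fin m') (x : Vec Bool m) (y : Vec Bool m') (ps : Pattern m) →
  (∀ ρ → lookupᵛ y (φ ρ) ≡ lookupᵛ x ρ) → matches y (mapRows φ ps) ≡ matches x ps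
matches-mapRows φ x y [] y∘φ≗x = refl
matches-mapRows φ x y ((ρ , b) ∷ ps) y∘φ≗x =
  cong₂ (λ u w → ⌊ u Boolₚ.≟ b ⌋ ∧ w) (y∘φ≗x ρ) (matches-mapRows φ x y ps y∘φ≗x)

matches-mapRows-zeros : ∀ {m m'} (φ : Fin m → Fin m') (x : Vec Bool m) (y : Vec Bool m') (ps : Pattern m) → Zeros ps →
  (∀ ρ → T (lookupᵛ y (φ ρ)) → T (lookupᵛ x ρ)) → T (matches x ps) → T (matches y (mapRows φ ps))
matches-mapRows-zeros φ x y ps zeros y⇒x x-matches = Equivalence.from (T-matches y (mapRows φ ps))
  (Allₚ.map⁺ (All.zipWith (λ { (x≡b , b≡false) → trans (vanishes (trans x≡b b≡false)) (sym b≡false) })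
                           (Equivalence.to (T-matches x ps) x-matches , zeros)))
  where
  vanishes : ∀ {ρ} → lookupᵛ x ρ ≡ false → lookupᵛ y (φ ρ) ≡ false
  vanishes {ρ} x≡false with lookupᵛ y (φ ρ) in y≡
  ... | false = refl
  ... | true = ⊥-elim (subst T x≡false (y⇒x ρ (subst T (sym y≡) _)))

consˡ : ∀ {p q} → Fin p ⊎ Fin q → Bool → Pattern p → Pattern p
consˡ (inj₁ i) b ps = (i , b) ∷ ps
consˡ (inj₂ _) b ps = ps

consʳ : ∀ {p q} → Fin p ⊎ Fin q → Bool → Pattern q → Pattern q
consʳ (inj₁ _) b ps = ps
consʳ (inj₂ j) b ps = (j , b) ∷ ps

patternˡ : ∀ p {q} → Pattern (p + q) → Pattern p
patternˡ p [] = []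
patternˡ p ((ρ , b) ∷ ps) = consˡ (splitAt p ρ) b (patternˡ p ps)

patternʳ : ∀ p {q} → Pattern (p + q) → Pattern q
patternʳ p [] = []
patternʳ p ((ρ , b) ∷ ps) = consʳ (splitAt p ρ) b (patternʳ p ps)

matches-++ : ∀ p {q} (a : Vec Bool p) (b : Vec Bool q) (ps : Pattern (p + q)) →
  matches (a ++ᵛ b) ps ≡ matches a (patternˡ p ps) ∧ matches b (patternʳ p ps)
matches-++ p a b [] = refl
matches-++ p a b ((ρ , c) ∷ ps) rewrite Vecₚ.lookup-splitAt p a b ρ | matches-++ p a b ps = by-side (splitAt p ρ)
  where
  fits : Bool → Bool
  fits u = ⌊ u Boolₚ.≟ c ⌋
  by-side : ∀ s → fits ([ lookupᵛ a , lookupᵛ b ]′ s) ∧ (matches a (patternˡ p ps) ∧ matches b (patternʳ p ps))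
                ≡ matches a (consˡ s c (patternˡ p ps)) ∧ matches b (consʳ s c (patternʳ p ps))
  by-side (inj₁ i) = sym (Boolₚ.∧-assoc (fits (lookupᵛ a i)) _ _)
  by-side (inj₂ j) = x∙yz≈y∙xz (fits (lookupᵛ b j)) (matches a (patternˡ p ps)) (matches b (patternʳ p ps))
    where
    open import Algebra.Properties.CommutativeSemigroup
      (CommutativeMonoid.commutativeSemigroup Boolₚ.∧-commutativeMonoid) using (x∙yz≈y∙xz)

countMatches-⊠ : ∀ {p q} (A : Mat p) (B : Mat q) (ps : Pattern (p + q)) →
  countMatches ps (A ⊠ B) ≡ countMatches (patternˡ p ps) A * countMatches (patternʳ p ps) B
countMatches-⊠ [] B ps = refl
countMatches-⊠ {p} (a ∷ A) B ps = begin
    countMatches ps (map (a ++ᵛ_) B ++ (A ⊠ B))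
  ≡⟨ countList-++ _ (map (a ++ᵛ_) B) (A ⊠ B) ⟩
    countMatches ps (map (a ++ᵛ_) B) + countMatches ps (A ⊠ B)
  ≡⟨ cong₂ _+_ column-a (countMatches-⊠ A B ps) ⟩
    fromBool (matches a psˡ) * countMatches psʳ B + countMatches psˡ A * countMatches psʳ B
  ≡⟨ *-distribʳ-+ _ (fromBool (matches a psˡ)) _ ⟨
    countMatches psˡ (a ∷ A) * countMatches psʳ B
  ∎
  where
  open ≡-Reasoning
  psˡ = patternˡ p ps
  psʳ = patternʳ p ps
  column-a : countMatches ps (map (a ++ᵛ_) B) ≡ fromBool (matches a psˡ) * countMatches psʳ B
  column-a = begin
    countMatches ps (map (a ++ᵛ_) B)                   ≡⟨ countList-map _ (a ++ᵛ_) B ⟩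
    countList (λ b → matches (a ++ᵛ b) ps) B            ≡⟨ countList-cong B (λ b → matches-++ p a b ps) ⟩
    countList (λ b → matches a psˡ ∧ matches b psʳ) B  ≡⟨ countList-∧ (matches a psˡ) _ B ⟩
    fromBool (matches a psˡ) * countMatches psʳ B      ∎

_⊕_ : ∀ {p p' q q'} → (Fin p → Fin p') → (Fin q → Fin q') → Fin (p + q) → Fin (p' + q')
_⊕_ {p} {p'} {q} {q'} φ χ = join p' q' ∘ Sum.map φ χ ∘ splitAt p

⊎-map-injective : ∀ {A B C D : Set} {f : A → C} {g : B → D} →
  Injective _≡_ _≡_ f → Injective _≡_ _≡_ g → Injective _≡_ _≡_ (Sum.map f g)
⊎-map-injective f-inj g-inj {inj₁ x} {inj₁ y} e = cong inj₁ (f-inj (Sumₚ.inj₁-injective e))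
⊎-map-injective f-inj g-inj {inj₂ x} {inj₂ y} e = cong inj₂ (g-inj (Sumₚ.inj₂-injective e))

⊕-injective : ∀ {p p' q q'} (φ : Fin p → Fin p') (χ : Fin q → Fin q') →
  Injective _≡_ _≡_ φ → Injective _≡_ _≡_ χ → Injective _≡_ _≡_ (φ ⊕ χ)
⊕-injective {p} {p'} {q} {q'} φ χ φ-inj χ-inj =
  Comp.injective _≡_ _≡_ _≡_ splitAt-injective
    (Comp.injective _≡_ _≡_ _≡_ (⊎-map-injective φ-inj χ-inj) join-injective)
  where
  splitAt-injective : Injective _≡_ _≡_ (splitAt p {q})
  splitAt-injective {x} {y} e = trans (sym (Finₚ.join-splitAt p q x)) (trans (cong (join p q) e) (Finₚ.join-splitAt p q y))
  join-injective : Injective _≡_ _≡_ (join p' q')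
  join-injective {x} {y} e = trans (sym (Finₚ.splitAt-join p' q' x)) (trans (cong (splitAt p') e) (Finₚ.splitAt-join p' q' y))

patternˡ-mapRows-⊕ : ∀ {p p' q q'} (φ : Fin p → Fin p') (χ : Fin q → Fin q') (ps : Pattern (p + q)) →
  patternˡ p' (mapRows (φ ⊕ χ) ps) ≡ mapRows φ (patternˡ p ps)
patternˡ-mapRows-⊕ φ χ [] = refl
patternˡ-mapRows-⊕ {p} {p'} {q} {q'} φ χ ((ρ , b) ∷ ps)
  rewrite Finₚ.splitAt-join p' q' (Sum.map φ χ (splitAt p ρ)) | patternˡ-mapRows-⊕ φ χ ps = by-side (splitAt p ρ)
  where
  by-side : ∀ s → consˡ (Sum.map φ χ s) b (mapRows φ (patternˡ p ps)) ≡ mapRows φ (consˡ s b (patternˡ p ps))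
  by-side (inj₁ _) = refl
  by-side (inj₂ _) = refl

patternʳ-mapRows-⊕ : ∀ {p p' q q'} (φ : Fin p → Fin p') (χ : Fin q → Fin q') (ps : Pattern (p + q)) →
  patternʳ p' (mapRows (φ ⊕ χ) ps) ≡ mapRows χ (patternʳ p ps)
patternʳ-mapRows-⊕ φ χ [] = refl
patternʳ-mapRows-⊕ {p} {p'} {q} {q'} φ χ ((ρ , b) ∷ ps)
  rewrite Finₚ.splitAt-join p' q' (Sum.map φ χ (splitAt p ρ)) | patternʳ-mapRows-⊕ φ χ ps = by-side (splitAt p ρ)
  where
  by-side : ∀ s → consʳ (Sum.map φ χ s) b (mapRows χ (patternʳ p ps)) ≡ mapRows χ (consʳ s b (patternʳ p ps))
  by-side (inj₁ _) = refl
  by-side (inj₂ _) = refl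

powRows : ∀ {r r'} n → (Fin r → Fin r') → Fin (n * r) → Fin (n * r')
powRows zero f ()
powRows (suc n) f = f ⊕ powRows n f

powRows-injective : ∀ {r r'} n (f : Fin r → Fin r') → Injective _≡_ _≡_ f → Injective _≡_ _≡_ (powRows n f)
powRows-injective zero f f-inj {()}
powRows-injective (suc n) f f-inj = ⊕-injective f (powRows n f) f-inj (powRows-injective n f f-inj)

_≟ᵛ_ : ∀ {k} → DecidableEquality (Vec Bool k)
_≟ᵛ_ = Vecₚ.≡-dec Boolₚ._≟_

multiplicity : ∀ {k} → Vec Bool k → Mat k → ℕ
multiplicity v F = countList (λ x → ⌊ x ≟ᵛ v ⌋) F

patternOf : ∀ {k m} → (Fin k → Fin m) → Vec Bool k → Pattern m
patternOf σ v = tabulate (λ i → σ i , lookupᵛ v i)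

restrict : ∀ {k m} → (Fin k → Fin m) → Vec Bool m → Vec Bool k
restrict σ x = tabulateᵛ (lookupᵛ x ∘ σ)

T-matches-patternOf : ∀ {k m} (σ : Fin k → Fin m) (v : Vec Bool k) (x : Vec Bool m) →
  T (matches x (patternOf σ v)) ⇔ restrict σ x ≡ v
T-matches-patternOf σ v x = mk⇔
  (λ m → trans (Vecₚ.tabulate-cong (Allₚ.tabulate⁻ (Equivalence.to (T-matches x _) m))) (Vecₚ.tabulate∘lookup v))
  (λ restrict≡v → Equivalence.from (T-matches x _) (Allₚ.tabulate⁺ (λ i →
     trans (sym (Vecₚ.lookup∘tabulate (lookupᵛ x ∘ σ) i)) (cong (λ w → lookupᵛ w i) restrict≡v))))

matches-patternOf : ∀ {k m} (σ : Fin k → Fin m) (v : Vec Bool k) (x : Vec Bool m) →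
  matches x (patternOf σ v) ≡ ⌊ restrict σ x ≟ᵛ v ⌋
matches-patternOf σ v x = T-extensional
  (fromWitness ∘ Equivalence.to (T-matches-patternOf σ v x))
  (Equivalence.from (T-matches-patternOf σ v x) ∘ toWitness)

Dominated : ∀ {k m} → (Fin k → Fin m) → Mat k → Mat m → Set
Dominated σ F A = ∀ v → multiplicity v F ≤ countMatches (patternOf σ v) A

≺⇒dominated : ∀ {k m} (F : Mat k) (A : Mat m) → F ≺ A →
  Σ (Fin k → Fin m) λ σ → Injective _≡_ _≡_ σ × Dominated σ F A
≺⇒dominated F A (σ , σ-inj , τ , τ-inj , entries) = σ , σ-inj , λ v →
  subst₂ _≤_ (sym (countList-lookup _ F)) (sym (countList-lookup _ A))
    (count-mono-injective (length F) (length A) _ _ τ τ-inj λ j Fj≡v →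
      Equivalence.from (T-matches-patternOf σ v (lookupᴸ A (τ j)))
        (trans (Vecₚ.tabulate-cong (λ i → entries i j)) (trans (Vecₚ.tabulate∘lookup _) (toWitness Fj≡v))))

dominated⇒≺ : ∀ {k m} (F : Mat k) (A : Mat m) (σ : Fin k → Fin m) →
  Injective _≡_ _≡_ σ → Dominated σ F A → F ≺ A
dominated⇒≺ F A σ σ-inj dominated = σ , σ-inj , τ , τ-inj , entries
  where
  embedding = embedding-from-counts _≟ᵛ_ (length F) (length A) (lookupᴸ F) (restrict σ ∘ lookupᴸ A) λ v →
    subst₂ _≤_ (countList-lookup _ F)
      (trans (countList-lookup _ A) (count-cong (length A) (λ i → matches-patternOf σ v (lookupᴸ A i))))
      (dominated v)
  τ = proj₁ embedding
  τ-inj = proj₁ (proj₂ embedding)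
  entries : ∀ i j → entry A (σ i) (τ j) ≡ entry F i j
  entries i j = trans (sym (Vecₚ.lookup∘tabulate _ i)) (cong (λ w → lookupᵛ w i) (proj₂ (proj₂ embedding) j))

multiplicity-∣∣-· : ∀ {k} (G H : Mat k) t v →
  multiplicity v (G ∣∣ (t · H)) ≡ multiplicity v G + t * multiplicity v H
multiplicity-∣∣-· G H t v =
  trans (countList-++ _ G _) (cong (multiplicity v G +_) (countList-concat-replicate _ t H))

fewer-copies-≺ : ∀ {k m} (G H : Mat k) (A : Mat m) {s t} → s ≤ t → (G ∣∣ (t · H)) ≺ A → (G ∣∣ (s · H)) ≺ A
fewer-copies-≺ G H A {s} {t} s≤t Ft≺A with σ , σ-inj , dominated ← ≺⇒dominated (G ∣∣ (t · H)) A Ft≺A =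
  dominated⇒≺ (G ∣∣ (s · H)) A σ σ-inj λ v → begin
    multiplicity v (G ∣∣ (s · H))                ≡⟨ multiplicity-∣∣-· G H s v ⟩
    multiplicity v G + s * multiplicity v H      ≤⟨ +-monoʳ-≤ (multiplicity v G) (*-monoˡ-≤ (multiplicity v H) s≤t) ⟩
    multiplicity v G + t * multiplicity v H      ≡⟨ multiplicity-∣∣-· G H t v ⟨
    multiplicity v (G ∣∣ (t · H))                ≤⟨ dominated v ⟩
    countMatches (patternOf σ v) A               ∎
  where open ≤-Reasoning

-- Amplifying row maps

countMatches-pow-zero : ∀ {r} (M : Mat r) (ps : Pattern 0) → countMatches ps (pow 0 M) ≡ 1
countMatches-pow-zero M [] = refl
countMatches-pow-zero M ((() , _) ∷ _)

2≤*⇒2≤⊎2≤ : ∀ a b → 2 ≤ a * b → 2 ≤ a ⊎ 2 ≤ b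
2≤*⇒2≤⊎2≤ (suc (suc a)) b _ = inj₁ (s≤s (s≤s z≤n))
2≤*⇒2≤⊎2≤ a (suc (suc b)) _ = inj₂ (s≤s (s≤s z≤n))
2≤*⇒2≤⊎2≤ (suc zero) (suc zero) (s≤s ())

module Amplification (t : ℕ) where

  record Amplifies {p q} (M : Mat p) (M' : Mat q) (φ : Fin p → Fin q) : Set where
    field
      preserves : ∀ ps → countMatches ps M ≤ countMatches (mapRows φ ps) M'
      amplifies : ∀ ps → 2 ≤ countMatches ps M → t * countMatches ps M ≤ countMatches (mapRows φ ps) M'

  open Amplifies

  amplifies-⊠ : ∀ {p p' q q'} {A : Mat p} {A' : Mat p'} {B : Mat q} {B' : Mat q'}
    {f : Fin p → Fin p'} {g : Fin q → Fin q'} →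
    Amplifies A A' f → Amplifies B B' g → Amplifies (A ⊠ B) (A' ⊠ B') (f ⊕ g)
  amplifies-⊠ {p} {p'} {q} {q'} {A} {A'} {B} {B'} {f} {g} amp-A amp-B = record
    { preserves = λ ps → subst₂ _≤_ (sym (countMatches-⊠ A B ps)) (sym (split ps))
                           (*-mono-≤ (preserves amp-A (patternˡ p ps)) (preserves amp-B (patternʳ p ps)))
    ; amplifies = λ ps 2≤ab → subst₂ (λ x y → t * x ≤ y) (sym (countMatches-⊠ A B ps)) (sym (split ps))
                           (product-amplifies ps (subst (2 ≤_) (countMatches-⊠ A B ps) 2≤ab))
    }
    where
    split : ∀ ps → countMatches (mapRows (f ⊕ g) ps) (A' ⊠ B')
                 ≡ countMatches (mapRows f (patternˡ p ps)) A' * countMatches (mapRows g (patternʳ p ps)) B'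
    split ps = trans (countMatches-⊠ A' B' (mapRows (f ⊕ g) ps))
                     (cong₂ (λ l r → countMatches l A' * countMatches r B')
                            (patternˡ-mapRows-⊕ f g ps) (patternʳ-mapRows-⊕ f g ps))
    product-amplifies : ∀ ps → let a = countMatches (patternˡ p ps) A ; b = countMatches (patternʳ p ps) B in
      2 ≤ a * b → t * (a * b) ≤ countMatches (mapRows f (patternˡ p ps)) A' * countMatches (mapRows g (patternʳ p ps)) B'
    product-amplifies ps 2≤ab with 2≤*⇒2≤⊎2≤ (countMatches (patternˡ p ps) A) _ 2≤ab
    ... | inj₁ 2≤a = ≤-trans (≤-reflexive (sym (*-assoc t (countMatches (patternˡ p ps) A) _)))
                       (*-mono-≤ (amplifies amp-A (patternˡ p ps) 2≤a) (preserves amp-B (patternʳ p ps)))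
    ... | inj₂ 2≤b = ≤-trans (≤-reflexive (x∙yz≈y∙xz t (countMatches (patternˡ p ps) A) _))
                       (*-mono-≤ (preserves amp-A (patternˡ p ps)) (amplifies amp-B (patternʳ p ps) 2≤b))
      where open import Algebra.Properties.CommutativeSemigroup *-commutativeSemigroup using (x∙yz≈y∙xz)

  amplifies-pow : ∀ {r r'} n {M : Mat r} {M' : Mat r'} {f : Fin r → Fin r'} →
    Amplifies M M' f → Amplifies (pow n M) (pow n M') (powRows n f)
  amplifies-pow zero {M} {M'} {f} _ = record
    { preserves = λ ps → ≤-reflexive
        (trans (countMatches-pow-zero M ps) (sym (countMatches-pow-zero M' (mapRows (powRows 0 f) ps))))
    ; amplifies = λ ps 2≤1 → ⊥-elim (<-irrefl refl (≤-trans 2≤1 (≤-reflexive (countMatches-pow-zero M ps))))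
    }
  amplifies-pow (suc n) amp = amplifies-⊠ amp (amplifies-pow n amp)

-- Blowing up P_r(a,b,c)

idCol : ∀ n → Fin n → Vec Bool n
idCol n j = tabulateᵛ (λ i → ⌊ i ≟ j ⌋)

lookup-idCol : ∀ n (j i : Fin n) → lookupᵛ (idCol n j) i ≡ ⌊ i ≟ j ⌋
lookup-idCol n j = Vecₚ.lookup∘tabulate _

countMatches-Iden : ∀ n (ps : Pattern n) → countMatches ps (Iden n) ≡ count n (λ j → matches (idCol n j) ps)
countMatches-Iden n ps = trans (countList-map _ (idCol n) (allFin n)) (countList-tabulate _ n (λ j → j))

triCol : ∀ n → Fin (suc n) → Vec Bool n
triCol n j = tabulateᵛ (λ i → toℕ i <ᵇ toℕ j)

countMatches-Tri : ∀ n (ps : Pattern n) → countMatches ps (Tri n) ≡ count (suc n) (λ j → matches (triCol n j) ps)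
countMatches-Tri n ps = trans (countList-map _ (triCol n) (allFin (suc n))) (countList-tabulate _ (suc n) (λ j → j))

flipPattern : ∀ {m} → Pattern m → Pattern m
flipPattern = map (map₂ not)

countMatches-IdenC : ∀ n (ps : Pattern n) → countMatches ps (IdenC n) ≡ countMatches (flipPattern ps) (Iden n)
countMatches-IdenC n ps = trans (countList-map _ (λ j → tabulateᵛ (λ i → not ⌊ i ≟ j ⌋)) (allFin n))
  (trans (countList-cong (allFin n) (λ j → complement-matches ps (λ ρ →
            trans (Vecₚ.lookup∘tabulate _ ρ) (cong not (sym (Vecₚ.lookup∘tabulate _ ρ))))))
         (sym (countList-map _ (idCol n) (allFin n))))
  where
  not-≟ : ∀ a b → ⌊ not a Boolₚ.≟ b ⌋ ≡ ⌊ a Boolₚ.≟ not b ⌋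
  not-≟ false false = refl
  not-≟ false true = refl
  not-≟ true false = refl
  not-≟ true true = refl
  complement-matches : ∀ {m} {x y : Vec Bool m} ps → (∀ ρ → lookupᵛ y ρ ≡ not (lookupᵛ x ρ)) →
    matches y ps ≡ matches x (flipPattern ps)
  complement-matches [] y≗¬x = refl
  complement-matches {x = x} ((ρ , b) ∷ ps) y≗¬x =
    cong₂ _∧_ (trans (cong (λ u → ⌊ u Boolₚ.≟ b ⌋) (y≗¬x ρ)) (not-≟ (lookupᵛ x ρ) b))
              (complement-matches ps y≗¬x)

-- R r = t' + rt is chosen so that T_{R r} has exactly t(r + 1) columns, t for each column of T_r.
module BlowUp (t' : ℕ) where

  t : ℕ
  t = suc t'

  open Amplification t
  open Amplifies

  R : ℕ → ℕ
  R r = t' + r * t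

  stretch : ∀ r → Fin r → Fin (R r)
  stretch r ρ = t' ↑ʳ combine ρ zero

  toℕ-stretch : ∀ r (ρ : Fin r) → toℕ (stretch r ρ) ≡ t' + t * toℕ ρ
  toℕ-stretch r ρ = trans (Finₚ.toℕ-↑ʳ t' (combine ρ zero))
                          (cong (t' +_) (trans (Finₚ.toℕ-combine ρ zero) (+-identityʳ (t * toℕ ρ))))

  stretch-injective : ∀ r → Injective _≡_ _≡_ (stretch r)
  stretch-injective r {x} {y} e =
    Finₚ.combine-injectiveˡ x zero y zero (Finₚ.↑ʳ-injective t' (combine x zero) (combine y zero) e)

  quotient-stretch : ∀ r (ρ : Fin r) (z : Fin (r * t)) → stretch r ρ ≡ t' ↑ʳ z → ρ ≡ quotient t z
  quotient-stretch r ρ z e = begin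
    ρ                             ≡⟨ cong proj₁ (Finₚ.remQuot-combine ρ zero) ⟨
    quotient t (combine ρ zero)   ≡⟨ cong (quotient t) (Finₚ.↑ʳ-injective t' (combine ρ zero) z e) ⟩
    quotient t z                  ∎
    where open ≡-Reasoning

  stretch-<-⇔ : ∀ a b u → u ≤ t' → t' + t * a < t * b + u ⇔ a < b
  stretch-<-⇔ a b u u≤t' = mk⇔ to from
    where
    to : t' + t * a < t * b + u → a < b
    to below with a <? b
    ... | yes a<b = a<b
    ... | no a≮b = ⊥-elim (<⇒≱ below
            (subst (_≤ t' + t * a) (+-comm u (t * b)) (+-mono-≤ u≤t' (*-monoʳ-≤ t (≮⇒≥ a≮b)))))
    from : a < b → t' + t * a < t * b + u
    from a<b = begin-strict
      t' + t * a   <⟨ n<1+n (t' + t * a) ⟩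
      t + t * a    ≡⟨ *-suc t a ⟨
      t * suc a    ≤⟨ *-monoʳ-≤ t a<b ⟩
      t * b        ≤⟨ m≤m+n (t * b) u ⟩
      t * b + u    ∎
      where open ≤-Reasoning

  toℕ-remQuot : ∀ {n} (z : Fin (n * t)) → toℕ z ≡ t * toℕ (quotient {n} t z) + toℕ (remainder {n} t z)
  toℕ-remQuot {n} z = trans (cong toℕ (sym (Finₚ.combine-remQuot {n} t z)))
                            (Finₚ.toℕ-combine (quotient {n} t z) (remainder {n} t z))

  triCol-stretch : ∀ r (z : Fin (suc (R r))) (ρ : Fin r) →
    lookupᵛ (triCol (R r) z) (stretch r ρ) ≡ lookupᵛ (triCol r (quotient t z)) ρ
  triCol-stretch r z ρ = begin
    lookupᵛ (triCol (R r) z) (stretch r ρ)         ≡⟨ Vecₚ.lookup∘tabulate _ (stretch r ρ) ⟩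
    toℕ (stretch r ρ) <ᵇ toℕ z                    ≡⟨ cong₂ _<ᵇ_ (toℕ-stretch r ρ) (toℕ-remQuot {suc r} z) ⟩
    t' + t * toℕ ρ <ᵇ t * toℕ q + toℕ u           ≡⟨ <ᵇ-cong (stretch-<-⇔ (toℕ ρ) (toℕ q) (toℕ u) u≤t') ⟩
    toℕ ρ <ᵇ toℕ q                                ≡⟨ Vecₚ.lookup∘tabulate _ ρ ⟨
    lookupᵛ (triCol r q) ρ                         ∎
    where
    open ≡-Reasoning
    q = quotient {suc r} t z
    u = remainder {suc r} t z
    u≤t' : toℕ u ≤ t'
    u≤t' = s≤s⁻¹ (Finₚ.toℕ<n u)

  amplifies-Tri : ∀ r → Amplifies (Tri r) (Tri (R r)) (stretch r)
  amplifies-Tri r = record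
    { preserves = λ ps → ≤-trans (m≤n*m (countMatches ps (Tri r)) t) (blow-up ps)
    ; amplifies = λ ps _ → blow-up ps
    }
    where
    blow-up : ∀ ps → t * countMatches ps (Tri r) ≤ countMatches (mapRows (stretch r) ps) (Tri (R r))
    blow-up ps = subst₂ (λ x y → t * x ≤ y) (sym (countMatches-Tri r ps))
                   (sym (countMatches-Tri (R r) (mapRows (stretch r) ps)))
      (count-blowup (suc r) (suc (R r)) t
        (λ j → matches (triCol r j) ps) (λ z → matches (triCol (R r) z) (mapRows (stretch r) ps))
        (λ z → z) (λ e → e) λ z matches-q →
        subst T (sym (matches-mapRows (stretch r) (triCol r (quotient t z)) (triCol (R r) z) ps (triCol-stretch r z))) matches-q)

  amplifies-Iden : ∀ r → Amplifies (Iden r) (Iden (R r)) (stretch r)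
  amplifies-Iden r = record
    { preserves = λ ps → subst₂ _≤_ (sym (countMatches-Iden r ps)) (sym (countMatches-Iden (R r) (mapRows (stretch r) ps)))
        (count-mono-injective r (R r) (p ps) (q ps) (stretch r) (stretch-injective r) λ j matches-j →
          subst T (sym (matches-mapRows (stretch r) (idCol r j) (idCol (R r) (stretch r j)) ps (idCol-stretch j))) matches-j)
    ; amplifies = λ ps 2≤c → subst₂ (λ x y → t * x ≤ y)
        (sym (countMatches-Iden r ps)) (sym (countMatches-Iden (R r) (mapRows (stretch r) ps)))
        (amplify ps (subst (2 ≤_) (countMatches-Iden r ps) 2≤c))
    }
    where
    p : Pattern r → Fin r → Bool
    p ps j = matches (idCol r j) ps
    q : Pattern r → Fin (R r) → Bool
    q ps z = matches (idCol (R r) z) (mapRows (stretch r) ps)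
    idCol-stretch : ∀ j ρ → lookupᵛ (idCol (R r) (stretch r j)) (stretch r ρ) ≡ lookupᵛ (idCol r j) ρ
    idCol-stretch j ρ = trans (lookup-idCol (R r) _ _)
      (trans (≟-injective (stretch r) (stretch-injective r) ρ j) (sym (lookup-idCol r j ρ)))
    -- A pattern prescribing a one matches at most one column of an identity matrix; a pattern of zeros
    -- matching column j of I_r matches the t columns t' + z of I_{R r} with ⌊z/t⌋ = j.
    amplify : ∀ ps → 2 ≤ count r (p ps) → t * count r (p ps) ≤ count (R r) (q ps)
    amplify ps 2≤c with prescribes-one-or-zeros ps
    ... | inj₁ (ρ₀ , ρ₀∈ps) = ⊥-elim (<-irrefl refl (≤-trans 2≤c (subst (count r (p ps) ≤_) (count-singleton r ρ₀)
            (count-mono-injective r r (p ps) (λ j → ⌊ ρ₀ ≟ j ⌋) (λ j → j) (λ e → e) λ j matches-j →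
              subst T (trans (sym (T-matches⇒lookup (idCol r j) ps matches-j ρ₀∈ps)) (lookup-idCol r j ρ₀)) _))))
    ... | inj₂ zeros = count-blowup r (R r) t (p ps) (q ps) (t' ↑ʳ_) (Finₚ.↑ʳ-injective t' _ _) λ z matches-z →
            matches-mapRows-zeros (stretch r) (idCol r (quotient t z)) (idCol (R r) (t' ↑ʳ z)) ps zeros
              (λ ρ one → subst T (sym (lookup-idCol r (quotient t z) ρ))
                (fromWitness (quotient-stretch r ρ z (toWitness (subst T (lookup-idCol (R r) (t' ↑ʳ z) (stretch r ρ)) one)))))
              matches-z

  amplifies-IdenC : ∀ r → Amplifies (IdenC r) (IdenC (R r)) (stretch r)
  amplifies-IdenC r = record
    { preserves = λ ps → subst₂ _≤_ (sym (countMatches-IdenC r ps)) (flipped ps) (preserves (amplifies-Iden r) (flipPattern ps))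
    ; amplifies = λ ps 2≤c → subst₂ (λ x y → t * x ≤ y) (sym (countMatches-IdenC r ps)) (flipped ps)
        (amplifies (amplifies-Iden r) (flipPattern ps) (subst (2 ≤_) (countMatches-IdenC r ps) 2≤c))
    }
    where
    flipped : ∀ ps → countMatches (mapRows (stretch r) (flipPattern ps)) (Iden (R r))
                   ≡ countMatches (mapRows (stretch r) ps) (IdenC (R r))
    flipped ps = trans (cong (λ ps' → countMatches ps' (Iden (R r)))
                         (trans (sym (Listₚ.map-∘ ps)) (Listₚ.map-∘ ps)))
                       (sym (countMatches-IdenC (R r) (mapRows (stretch r) ps)))

  stretchP : ∀ r a b c → Fin (a * r + (b * r + c * r)) → Fin (a * R r + (b * R r + c * R r))
  stretchP r a b c = powRows a (stretch r) ⊕ (powRows b (stretch r) ⊕ powRows c (stretch r))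

  stretchP-injective : ∀ r a b c → Injective _≡_ _≡_ (stretchP r a b c)
  stretchP-injective r a b c = ⊕-injective _ _ (powRows-injective a _ (stretch-injective r))
    (⊕-injective _ _ (powRows-injective b _ (stretch-injective r)) (powRows-injective c _ (stretch-injective r)))

  amplifies-P : ∀ r a b c → Amplifies (P r a b c) (P (R r) a b c) (stretchP r a b c)
  amplifies-P r a b c = amplifies-⊠ (amplifies-pow a (amplifies-Iden r))
    (amplifies-⊠ (amplifies-pow b (amplifies-IdenC r)) (amplifies-pow c (amplifies-Tri r)))

  -- g and h are the multiplicities of a column in G and H; if h > 0 the column occurs twice in
  -- [G | 2·H], so the number x of columns matching it gets amplified.
  copies-bound : ∀ g h x y → g + 2 * h ≤ x → x ≤ y → (2 ≤ x → t * x ≤ y) → g + t * h ≤ y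
  copies-bound g zero x y g≤x x≤y _ rewrite *-zeroʳ t = ≤-trans g≤x x≤y
  copies-bound g (suc h) x y g+2h≤x _ amplify = begin
    g + t * suc h          ≤⟨ +-mono-≤ (m≤n*m g t) (*-monoʳ-≤ t (m≤m+n (suc h) (suc h + 0))) ⟩
    t * g + t * (2 * suc h) ≡⟨ *-distribˡ-+ t g (2 * suc h) ⟨
    t * (g + 2 * suc h)    ≤⟨ *-monoʳ-≤ t g+2h≤x ⟩
    t * x                  ≤⟨ amplify (≤-trans (m≤n+m 2 g) (≤-trans (+-monoʳ-≤ g (*-monoʳ-≤ 2 (s≤s z≤n))) g+2h≤x)) ⟩
    y                      ∎
    where open ≤-Reasoning

  more-copies-≺-stretched-P : ∀ {k} (G H : Mat k) r a b c →
    (G ∣∣ (2 · H)) ≺ P r a b c → (G ∣∣ (t · H)) ≺ P (R r) a b c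
  more-copies-≺-stretched-P G H r a b c F₂≺P
    with σ , σ-inj , dominated ← ≺⇒dominated (G ∣∣ (2 · H)) (P r a b c) F₂≺P =
    dominated⇒≺ (G ∣∣ (t · H)) (P (R r) a b c) (ψ ∘ σ) (σ-inj ∘ ψ-inj) λ v →
      subst₂ _≤_ (sym (multiplicity-∣∣-· G H t v))
        (cong (λ ps → countMatches ps (P (R r) a b c)) (Listₚ.map-tabulate (λ i → σ i , lookupᵛ v i) (map₁ ψ)))
        (copies-bound (multiplicity v G) (multiplicity v H) _ _
          (subst (_≤ _) (multiplicity-∣∣-· G H 2 v) (dominated v))
          (preserves (amplifies-P r a b c) (patternOf σ v))
          (amplifies (amplifies-P r a b c) (patternOf σ v)))
    where
    ψ = stretchP r a b c
    ψ-inj = stretchP-injective r a b c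

  1≤R : ∀ r → 1 ≤ r → 1 ≤ R r
  1≤R r 1≤r = ≤-trans 1≤r (≤-trans (m≤m*n r t) (m≤n+m (r * t) t'))

-- The numbers X(F_t)

attainable-fewer-copies : ∀ {k} (G H : Mat k) {s t} → s ≤ t → ∀ N →
  Attainable (G ∣∣ (s · H)) N → Attainable (G ∣∣ (t · H)) N
attainable-fewer-copies G H s≤t N (a , b , c , a+b+c≡N , avoids) =
  a , b , c , a+b+c≡N , λ r 1≤r Fₜ≺P → avoids r 1≤r (fewer-copies-≺ G H (P r a b c) s≤t Fₜ≺P)

attainable-more-copies : ∀ {k} (G H : Mat k) t' N →
  Attainable (G ∣∣ (suc t' · H)) N → Attainable (G ∣∣ (2 · H)) N
attainable-more-copies G H t' N (a , b , c , a+b+c≡N , avoids) =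
  a , b , c , a+b+c≡N , λ r 1≤r F₂≺P → avoids (R r) (1≤R r 1≤r) (more-copies-≺-stretched-P G H r a b c F₂≺P)
  where open BlowUp t'

attainable-copies : ∀ {k} (G H : Mat k) t → 2 ≤ t → ∀ N →
  Attainable (G ∣∣ (2 · H)) N ⇔ Attainable (G ∣∣ (t · H)) N
attainable-copies G H (suc t') 2≤t N = mk⇔ (attainable-fewer-copies G H 2≤t N) (attainable-more-copies G H t' N)

IsX-cong : ∀ {k l} {F : Mat k} {F' : Mat l} → (∀ N → Attainable F N ⇔ Attainable F' N) → ∀ N → IsX F N ⇔ IsX F' N
IsX-cong same N = mk⇔
  (λ (att , max) → Equivalence.to (same N) att , λ N' att' → max N' (Equivalence.from (same N') att'))
  (λ (att , max) → Equivalence.from (same N) att , λ N' att' → max N' (Equivalence.to (same N') att'))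

BigΘ-sym : ∀ {f g} → BigΘ f g → BigΘ g f
BigΘ-sym (c₁ , c₂ , m₀ , bounds) = c₂ , c₁ , m₀ , λ m m₀≤m → swap (bounds m m₀≤m)

BigΘ-trans : ∀ {f g h} → BigΘ f g → BigΘ g h → BigΘ f h
BigΘ-trans {f} {g} {h} (c₁ , c₂ , m₀ , f~g) (d₁ , d₂ , n₀ , g~h) =
  c₁ * d₁ , d₂ * c₂ , m₀ + n₀ , λ m m₀+n₀≤m →
  let f≤g , g≤f = f~g m (≤-trans (m≤m+n m₀ n₀) m₀+n₀≤m)
      g≤h , h≤g = g~h m (≤-trans (m≤n+m n₀ m₀) m₀+n₀≤m)
  in ≤-trans f≤g (≤-trans (*-monoʳ-≤ c₁ g≤h) (≤-reflexive (sym (*-assoc c₁ d₁ (h m))))) ,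
     ≤-trans h≤g (≤-trans (*-monoʳ-≤ d₂ g≤f) (≤-reflexive (sym (*-assoc d₂ c₂ (f m)))))

mainTheorem3 : ∀ k (G H : Mat k) → Simple G → Simple H → NoCommonColumns G H →
    (∀ t → 2 ≤ t → ∀ N → IsX (G ∣∣ (2 · H)) N ⇔ IsX (G ∣∣ (t · H)) N)
    × (ForbConjecture → ∀ t → 2 ≤ t → ∀ X → IsX (G ∣∣ (2 · H)) X →
        ∀ (f g : ℕ → ℕ) → (∀ m → IsForb m (G ∣∣ (t · H)) (f m)) →
        (∀ m → IsForb m (G ∣∣ (2 · H)) (g m)) → BigΘ f g)
mainTheorem3 k G H _ _ _ = same-X , same-growth
  where
  same-X : ∀ t → 2 ≤ t → ∀ N → IsX (G ∣∣ (2 · H)) N ⇔ IsX (G ∣∣ (t · H)) N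
  same-X t 2≤t = IsX-cong {F = G ∣∣ (2 · H)} {F' = G ∣∣ (t · H)} (attainable-copies G H t 2≤t)
  same-growth : ForbConjecture → ∀ t → 2 ≤ t → ∀ X → IsX (G ∣∣ (2 · H)) X →
    ∀ (f g : ℕ → ℕ) → (∀ m → IsForb m (G ∣∣ (t · H)) (f m)) →
    (∀ m → IsForb m (G ∣∣ (2 · H)) (g m)) → BigΘ f g
  same-growth conjecture t 2≤t X X-F₂ f g forb-Fₜ forb-F₂ =
    BigΘ-trans (conjecture k (G ∣∣ (t · H)) X (Equivalence.to (same-X t 2≤t X) X-F₂) f forb-Fₜ)
               (BigΘ-sym (conjecture k (G ∣∣ (2 · H)) X X-F₂ g forb-F₂))
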